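{- Consider the following search problem. An unknown multiset $S$ of $k$ integers, each in $\{1,\dots,n\}$, is fixed. An algorithm repeatedly chooses a query $Y\in\{1,\dots,n\}$; each time, an element $X$ of $S$ is selected uniformly at random, independently of everything else, and the algorithm is told only whether $X\le Y$ or $X>Y$. When $k\ge n$, for every constant $c>0$ there is an algorithm making $O(k^2 n\log n)$ queries that finds all $k$ integers of $S$ with probability at least $1-n^{ -c}$.
   Context: Queries are the only cost measure; the constant in $O(\cdot)$ may depend on $c$. -}

module Defs where

open import Data.Nat as ℕ using (ℕ; zero; suc)
open import Data.Fin using (Fin; toℕ)
open import Data.Fin.Properties using (_≤?_)
open import Data.Vec using (Vec; []; _∷_)
open import Data.Bool using (Bool; true; false; if_then_else_; _∧_)
open import Data.List using (allFin)
open import Data.List.Base using (all)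
open import Data.Integer using (+_)
open import Data.Rational using (ℚ; 0ℚ; 1ℚ; _+_; _*_; _-_; _/_)
open import Relation.Nullary.Decidable using (⌊_⌋)

-- An (adaptive, possibly randomised) algorithm for the search problem with
-- values in {1,…,n}, represented by Fin n (i : Fin n stands for toℕ i + 1),
-- is a finite decision tree:
--  * done m     : stop and output the multiset whose multiplicity of value i is m i;
--  * query y l r: ask query Y = y; continue with l if the sampled X ≤ Y,
--                 with r if X > Y;
--  * coin l r   : flip an internal fair coin (not counted as a query).
data Alg (n : ℕ) : Set where
  done  : (Fin n → ℕ) → Alg n
  query : Fin n → Alg n → Alg n → Alg n
  coin  : Alg n → Alg n → Alg n

queries : ∀ {n} → Alg n → ℕ
queries (done _)      = 0
queries (query _ l r) = suc (queries l ℕ.⊔ queries r)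
queries (coin l r)    = queries l ℕ.⊔ queries r

mult : ∀ {n k} → Fin n → Vec (Fin n) k → ℕ
mult i []      = 0
mult i (x ∷ S) = (if ⌊ toℕ x ℕ.≟ toℕ i ⌋ then 1 else 0) ℕ.+ mult i S

countLe : ∀ {n k} → Fin n → Vec (Fin n) k → ℕ
countLe y []      = 0
countLe y (x ∷ S) = (if ⌊ x ≤? y ⌋ then 1 else 0) ℕ.+ countLe y S

-- a / d as a rational (d = 0 gives 0; never used since k ≥ 1)
frac : ℕ → ℕ → ℚ
frac a zero    = 0ℚ
frac a (suc d) = (+ a) / suc d

correct : ∀ {n k} → Vec (Fin n) k → (Fin n → ℕ) → Bool
correct {n} S m = all (λ i → ⌊ m i ℕ.≟ mult i S ⌋) (allFin n)

half : ℚ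
half = + 1 / 2

-- probability that the algorithm outputs exactly S, when each answer is
-- generated from an element X of S chosen uniformly at random, independently
successProb : ∀ {n k} → Vec (Fin n) k → Alg n → ℚ
successProb S (done m)      = if correct S m then 1ℚ else 0ℚ
successProb {k = k} S (query y l r) =
  let p = frac (countLe y S) k in
  p * successProb S l + (1ℚ - p) * successProb S r
successProb S (coin l r)    = half * successProb S l + half * successProb S r

powℚ : ℚ → ℕ → ℚ
powℚ q zero    = 1ℚ
powℚ q (suc e) = q * powℚ q e

-- Repeating the query y, the answers "X ≤ y" are independent, each with probability p_y = c_y / k
-- where c_y = #{X ∈ S | X ≤ y}. Among 16k² queries y their number has mean 16k c_y and variance at
-- most 4k², so by Chebyshev's inequality rounding it to the nearest multiple of 16k returns c_y
-- except with probability at most 1/16. A majority vote over L such estimates is wrong only if at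
-- least half of them are, so Markov's inequality for the product of the independent weights
-- 4^[estimate wrong], each of mean at most 19/16, bounds its failure probability by (19/32)^L.
-- With L = 3(a+1)⌊log₂ n⌋ a union bound over the n thresholds y yields all c_y, hence all the
-- multiplicities c_y − c_(y−1), except with probability n (19/32)^L ≤ n^(−a), because
-- n ≤ 4^⌊log₂ n⌋ and 4 · 19³ ≤ 32³. This costs n · L · 16k² = 48(a+1) k² n ⌊log₂ n⌋ queries;
-- the hypothesis k ≥ n is only needed for k ≥ 1.
module Submission where

open import Data.Nat.Base as ℕ using (ℕ; zero; suc; NonZero)
import Data.Nat.Properties as ℕ
open import Data.Nat.Logarithm using (⌊log₂_⌋)
open import Data.Fin.Base using (Fin; zero; suc)
open import Data.Vec.Base using (Vec)
open import Data.Vec.Functional as Vector using (Vector; head; tail)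
open import Data.Bool.Base using (Bool; true; false; if_then_else_)
open import Data.Product.Base using (∃; _×_; _,_)
open import Data.Sum.Base using (_⊎_; inj₁; inj₂)
open import Function.Base using (_∘_; const)
open import Relation.Nullary.Decidable using (⌊_⌋; yes; no)
open import Relation.Nullary.Negation using (contradiction)
open import Relation.Binary.PropositionalEquality

open import Defs using (Alg; done; query; queries; powℚ; frac; countLe; correct; successProb)

module Majority where
  open import Data.Nat.Base using (_+_; _*_; _^_; _≤_; _<_; z≤n; s≤s)
  open import Data.Nat.Properties
  open import Algebra.Properties.CommutativeSemigroup +-commutativeSemigroup using (interchange)
  open ≤-Reasoning

  miss : ℕ → ℕ → ℕ
  miss c a = if ⌊ a ≟ c ⌋ then 0 else 1

  mismatches : ∀ {m} → Vector ℕ m → Vector ℕ m → ℕ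
  mismatches {zero}  c x = 0
  mismatches {suc m} c x = miss (head c) (head x) + mismatches (tail c) (tail x)

  HasMajority : ∀ {m} → ℕ → Vector ℕ m → Set
  HasMajority {m} c x = 2 * mismatches (const c) x < m

  majority : ∀ {m} → ℕ → Vector ℕ m → ℕ
  majority     zero    x = 0
  majority {m} (suc K) x = if ⌊ 2 * mismatches (const (suc K)) x <? m ⌋ then suc K else majority K x

  miss-self : ∀ c → miss c c ≡ 0
  miss-self c with c ≟ c
  ... | yes _  = refl
  ... | no c≢c = contradiction refl c≢c

  miss≤1 : ∀ c a → miss c a ≤ 1
  miss≤1 c a with a ≟ c
  ... | yes _ = z≤n
  ... | no _  = s≤s z≤n

  miss≡0⇒≡ : ∀ c a → miss c a ≡ 0 → a ≡ c
  miss≡0⇒≡ c a _ with a ≟ c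
  ... | yes a≡c = a≡c

  miss-distinct : ∀ {b c} → b ≢ c → ∀ a → 1 ≤ miss b a + miss c a
  miss-distinct {b} {c} b≢c a with a ≟ b | a ≟ c
  ... | yes refl | yes refl = contradiction refl b≢c
  ... | yes _    | no _     = s≤s z≤n
  ... | no _     | _        = s≤s z≤n

  mismatches≡0⇒≗ : ∀ {m} (c x : Vector ℕ m) → mismatches c x ≡ 0 → ∀ i → x i ≡ c i
  mismatches≡0⇒≗ c x none zero    = miss≡0⇒≡ (head c) (head x) (m+n≡0⇒m≡0 _ none)
  mismatches≡0⇒≗ c x none (suc i) =
    mismatches≡0⇒≗ (tail c) (tail x) (m+n≡0⇒n≡0 (miss (head c) (head x)) none) i

  mismatches-distinct : ∀ {m b c} → b ≢ c → (x : Vector ℕ m) →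
                        m ≤ mismatches (const b) x + mismatches (const c) x
  mismatches-distinct {zero}          b≢c x = z≤n
  mismatches-distinct {suc m} {b} {c} b≢c x = begin
    1 + m
      ≤⟨ +-mono-≤ (miss-distinct b≢c (head x)) (mismatches-distinct b≢c (tail x)) ⟩
    (miss b (head x) + miss c (head x)) + (mismatches (const b) (tail x) + mismatches (const c) (tail x))
      ≡⟨ interchange (miss b (head x)) _ _ _ ⟩
    mismatches (const b) x + mismatches (const c) x
      ∎

  majority-unique : ∀ {m b c} (x : Vector ℕ m) → HasMajority b x → HasMajority c x → b ≡ c
  majority-unique {m} {b} {c} x maj-b maj-c with b ≟ c
  ... | yes b≡c = b≡c
  ... | no b≢c  = contradiction (begin-strict
    2 * m                                                   ≤⟨ *-monoʳ-≤ 2 (mismatches-distinct b≢c x) ⟩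
    2 * (mismatches (const b) x + mismatches (const c) x)   ≡⟨ *-distribˡ-+ 2 (mismatches (const b) x) _ ⟩
    2 * mismatches (const b) x + 2 * mismatches (const c) x <⟨ +-mono-< maj-b maj-c ⟩
    m + m                                                   ≡⟨ cong (m +_) (+-identityʳ m) ⟨
    2 * m                                                   ∎) (<-irrefl refl)

  majority-correct : ∀ {m c} K (x : Vector ℕ m) → c ≤ K → HasMajority c x → majority K x ≡ c
  majority-correct zero x z≤n _ = refl
  majority-correct {m} {c} (suc K) x c≤K maj-c with 2 * mismatches (const (suc K)) x <? m
  ... | yes maj-K = majority-unique x maj-K maj-c
  ... | no ¬maj-K = majority-correct K x (≤-pred (≤∧≢⇒< c≤K c≢K)) maj-c
    where
    c≢K : c ≢ suc K
    c≢K refl = ¬maj-K maj-c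

  majority-miss-bound : ∀ {m c} K (x : Vector ℕ m) → c ≤ K →
                        2 ^ m * miss c (majority K x) ≤ 4 ^ mismatches (const c) x
  majority-miss-bound {m} {c} K x c≤K with 2 * mismatches (const c) x <? m
  ... | yes maj-c = begin
    2 ^ m * miss c (majority K x) ≡⟨ cong (λ a → 2 ^ m * miss c a) (majority-correct K x c≤K maj-c) ⟩
    2 ^ m * miss c c              ≡⟨ cong (2 ^ m *_) (miss-self c) ⟩
    2 ^ m * 0                     ≡⟨ *-zeroʳ (2 ^ m) ⟩
    0                             ≤⟨ z≤n ⟩
    4 ^ mismatches (const c) x    ∎
  ... | no ¬maj-c = begin
    2 ^ m * miss c (majority K x) ≤⟨ *-monoʳ-≤ (2 ^ m) (miss≤1 c (majority K x)) ⟩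
    2 ^ m * 1                     ≡⟨ *-identityʳ (2 ^ m) ⟩
    2 ^ m                         ≤⟨ ^-monoʳ-≤ 2 (≮⇒≥ ¬maj-c) ⟩
    2 ^ (2 * M)                   ≡⟨ ^-*-assoc 2 2 M ⟨
    4 ^ M                         ∎
    where M = mismatches (const c) x

open Majority

module NatArithmetic where
  open import Data.Nat.Base using (_+_; _*_; _^_; _≤_; _<_; z≤n; s≤s; _/_)
  open import Data.Nat.Properties
  open import Data.Nat.Tactic.RingSolver using (solve-∀)
  open import Data.Nat.DivMod using (m<n*o⇒m/o<n; /-monoˡ-≤; m*n/n≡m)
  open import Data.Nat.Logarithm using (⌊log₂⌋-mono-≤; ⌊log₂[2^n]⌋≡n)
  open import Algebra.Properties.CommutativeSemigroup *-commutativeSemigroup using (interchange)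
  open ≤-Reasoning

  ^-distrib-* : ∀ m n o → (m * n) ^ o ≡ m ^ o * n ^ o
  ^-distrib-* m n zero    = refl
  ^-distrib-* m n (suc o) = trans (cong (m * n *_) (^-distrib-* m n o)) (interchange m n (m ^ o) (n ^ o))

  /-≡-from-bounds : ∀ {m d q} .{{_ : NonZero d}} → q * d ≤ m → m < suc q * d → m / d ≡ q
  /-≡-from-bounds {m} {d} {q} lower upper = ≤-antisym (≤-pred (m<n*o⇒m/o<n upper)) (begin
    q           ≡⟨ m*n/n≡m q d ⟨
    q * d / d   ≤⟨ /-monoˡ-≤ d lower ⟩
    m / d       ∎)

  -- (m + h) / 2h rounds m to the nearest multiple of 2h
  round-≢⇒far : ∀ m h c .{{_ : NonZero (2 * h)}} → (m + h) / (2 * h) ≢ c →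
                h + 2 * h * c ≤ m ⊎ h + m ≤ 2 * h * c
  round-≢⇒far m h c round≢c with 2 * h * c ≤? m + h | m + h <? 2 * h * c + 2 * h
  ... | no  below | _        = inj₂ (subst (_≤ 2 * h * c) (+-comm m h) (<⇒≤ (≰⇒> below)))
  ... | yes _     | no above = inj₁ (+-cancelʳ-≤ h (h + 2 * h * c) m
                                      (subst (_≤ m + h) (regroup h (2 * h * c)) (≮⇒≥ above)))
    where
    regroup : ∀ h μ → μ + 2 * h ≡ h + μ + h
    regroup = solve-∀
  ... | yes lower | yes upper = contradiction (/-≡-from-bounds
    (subst (_≤ m + h) (*-comm (2 * h) c) lower)
    (subst (m + h <_) (trans (+-comm (2 * h * c) (2 * h)) (cong (2 * h +_) (*-comm (2 * h) c))) upper))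
    round≢c

  n<2^[1+⌊log₂n⌋] : ∀ n → n < 2 ^ suc ⌊log₂ n ⌋
  n<2^[1+⌊log₂n⌋] n with n <? 2 ^ suc ⌊log₂ n ⌋
  ... | yes n<2^[1+ℓ] = n<2^[1+ℓ]
  ... | no  n≮2^[1+ℓ] = contradiction (begin
    suc ⌊log₂ n ⌋                  ≡⟨ ⌊log₂[2^n]⌋≡n (suc ⌊log₂ n ⌋) ⟨
    ⌊log₂ 2 ^ suc ⌊log₂ n ⌋ ⌋      ≤⟨ ⌊log₂⌋-mono-≤ (≮⇒≥ n≮2^[1+ℓ]) ⟩
    ⌊log₂ n ⌋                      ∎) (<-irrefl refl)

  n≤4^⌊log₂n⌋ : ∀ n → n ≤ 4 ^ ⌊log₂ n ⌋
  n≤4^⌊log₂n⌋ n with ⌊log₂ n ⌋ | n<2^[1+⌊log₂n⌋] n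
  ... | zero  | n<2       = ≤-pred n<2
  ... | suc ℓ | n<2^[2+ℓ] = begin
    n                       ≤⟨ <⇒≤ n<2^[2+ℓ] ⟩
    2 * 2 ^ suc ℓ           ≤⟨ *-monoˡ-≤ (2 ^ suc ℓ) (^-monoʳ-≤ 2 {1} {suc ℓ} (s≤s z≤n)) ⟩
    2 ^ suc ℓ * 2 ^ suc ℓ   ≡⟨ ^-distrib-* 2 2 (suc ℓ) ⟨
    4 ^ suc ℓ               ∎

  -- 19/32 = (1 + 3 · 1/16) / 2 is the failure factor per vote of the majority, and 4 · 19³ ≤ 32³
  n^[1+a]*19^L≤32^L : ∀ n a ℓ → n ≤ 4 ^ ℓ → n ^ suc a * 19 ^ (3 * (suc a * ℓ)) ≤ 32 ^ (3 * (suc a * ℓ))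
  n^[1+a]*19^L≤32^L n a ℓ n≤4^ℓ = begin
    n ^ suc a * 19 ^ (3 * X)        ≤⟨ *-monoˡ-≤ (19 ^ (3 * X)) (^-monoˡ-≤ (suc a) n≤4^ℓ) ⟩
    (4 ^ ℓ) ^ suc a * 19 ^ (3 * X)  ≡⟨ cong₂ _*_ (trans (^-*-assoc 4 ℓ (suc a)) (cong (4 ^_) (*-comm ℓ (suc a))))
                                                  (sym (^-*-assoc 19 3 X)) ⟩
    4 ^ X * (19 ^ 3) ^ X            ≡⟨ ^-distrib-* 4 (19 ^ 3) X ⟨
    (4 * 19 ^ 3) ^ X                ≤⟨ ^-monoˡ-≤ X (m≤m+n (4 * 19 ^ 3) 5332) ⟩
    (32 ^ 3) ^ X                    ≡⟨ ^-*-assoc 32 3 X ⟩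
    32 ^ (3 * X)                    ∎
    where X = suc a * ℓ

open NatArithmetic

module Multiplicities where
  open import Data.Nat.Base using (_+_; _∸_; _≤_; z≤n)
  open import Data.Nat.Properties
  open import Algebra.Properties.CommutativeSemigroup +-commutativeSemigroup using (interchange)
  open import Data.Fin.Base using (toℕ; inject₁)
  open import Data.Fin.Properties using (toℕ-inject₁)
  open import Data.Vec.Base using ([]; _∷_)
  open import Data.List.Relation.Unary.All.Properties using (all⁻; tabulate⁺)
  open import Data.Bool.Properties using (T-≡)
  open import Function.Bundles using (Equivalence)
  open import Relation.Nullary.Decidable using (Dec; fromWitness)
  open import Defs using (mult)
  open ≡-Reasoning

  differences : ∀ {n} → (Fin n → ℕ) → Fin n → ℕ
  differences f zero    = f zero
  differences f (suc i) = f (suc i) ∸ f (inject₁ i)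

  bit : ∀ {A : Set} → Dec A → ℕ
  bit d = if ⌊ d ⌋ then 1 else 0

  bit≤1 : ∀ {A : Set} (d : Dec A) → bit d ≤ 1
  bit≤1 d with ⌊ d ⌋
  ... | true  = ≤-refl
  ... | false = z≤n

  bit-≤-zero : ∀ a → bit (a ≤? 0) ≡ bit (a ≟ 0)
  bit-≤-zero a with a ≤? 0 | a ≟ 0
  ... | yes _   | yes _    = refl
  ... | yes z≤n | no a≢0   = contradiction refl a≢0
  ... | no a≰0  | yes refl = contradiction z≤n a≰0
  ... | no _    | no _     = refl

  bit-≤-suc : ∀ a b → bit (a ≤? suc b) ≡ bit (a ≤? b) + bit (a ≟ suc b)
  bit-≤-suc a b with a ≤? b | a ≟ suc b | a ≤? suc b
  ... | yes a≤b | yes refl | _         = contradiction a≤b 1+n≰n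
  ... | yes a≤b | no _     | no a≰1+b  = contradiction (m≤n⇒m≤1+n a≤b) a≰1+b
  ... | yes _   | no _     | yes _     = refl
  ... | no _    | yes refl | no a≰a    = contradiction ≤-refl a≰a
  ... | no _    | yes _    | yes _     = refl
  ... | no a≰b  | no a≢1+b | yes a≤1+b = contradiction (≤-antisym a≤1+b (≰⇒> a≰b)) a≢1+b
  ... | no _    | no _     | no _      = refl

  countLe≤length : ∀ {n k} y (S : Vec (Fin n) k) → countLe y S ≤ k
  countLe≤length y []      = z≤n
  countLe≤length y (x ∷ S) = +-mono-≤ (bit≤1 (toℕ x ≤? toℕ y)) (countLe≤length y S)

  countLe-zero : ∀ {n k} (S : Vec (Fin (suc n)) k) → countLe zero S ≡ mult zero S
  countLe-zero []      = refl
  countLe-zero (x ∷ S) = cong₂ _+_ (bit-≤-zero (toℕ x)) (countLe-zero S)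

  countLe-suc : ∀ {n k} (j : Fin n) (S : Vec (Fin (suc n)) k) →
                countLe (suc j) S ≡ countLe (inject₁ j) S + mult (suc j) S
  countLe-suc j []      = refl
  countLe-suc j (x ∷ S) = begin
    bit (toℕ x ≤? suc (toℕ j)) + countLe (suc j) S
      ≡⟨ cong₂ _+_ (bit-≤-suc (toℕ x) (toℕ j)) (countLe-suc j S) ⟩
    (x≤j + x≡1+j) + (countLe (inject₁ j) S + mult (suc j) S)
      ≡⟨ interchange x≤j x≡1+j (countLe (inject₁ j) S) (mult (suc j) S) ⟩
    (x≤j + countLe (inject₁ j) S) + mult (suc j) (x ∷ S)
      ≡⟨ cong (λ t → (bit (toℕ x ≤? t) + countLe (inject₁ j) S) + mult (suc j) (x ∷ S)) (toℕ-inject₁ j) ⟨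
    countLe (inject₁ j) (x ∷ S) + mult (suc j) (x ∷ S)
      ∎
    where
    x≤j = bit (toℕ x ≤? toℕ j)
    x≡1+j = bit (toℕ x ≟ suc (toℕ j))

  differences-countLe : ∀ {n k} (S : Vec (Fin n) k) {f} → (∀ y → f y ≡ countLe y S) →
                        ∀ i → differences f i ≡ mult i S
  differences-countLe S     f≗countLe zero    = trans (f≗countLe zero) (countLe-zero S)
  differences-countLe S {f} f≗countLe (suc j) = begin
    f (suc j) ∸ f (inject₁ j)
      ≡⟨ cong₂ _∸_ (f≗countLe (suc j)) (f≗countLe (inject₁ j)) ⟩
    countLe (suc j) S ∸ countLe (inject₁ j) S
      ≡⟨ cong (_∸ countLe (inject₁ j) S) (countLe-suc j S) ⟩
    countLe (inject₁ j) S + mult (suc j) S ∸ countLe (inject₁ j) S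
      ≡⟨ m+n∸m≡n (countLe (inject₁ j) S) (mult (suc j) S) ⟩
    mult (suc j) S
      ∎

  correct-differences : ∀ {n k} (S : Vec (Fin n) k) {f} → (∀ y → f y ≡ countLe y S) →
                        correct S (differences f) ≡ true
  correct-differences S f≗countLe = Equivalence.to T-≡
    (all⁻ _ (tabulate⁺ λ i → fromWitness (differences-countLe S f≗countLe i)))

open Multiplicities

-- An Alg without coin flips whose leaves may carry results of any type, so that algorithms
-- compose as a monad.
data QueryTree (n : ℕ) (A : Set) : Set where
  leaf : A → QueryTree n A
  node : Fin n → QueryTree n A → QueryTree n A → QueryTree n A

module _ {n : ℕ} where

  infixl 1 _>>=_
  infixl 4 _<$>_

  _>>=_ : ∀ {A B} → QueryTree n A → (A → QueryTree n B) → QueryTree n B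
  leaf a     >>= h = h a
  node y l r >>= h = node y (l >>= h) (r >>= h)

  _<$>_ : ∀ {A B} → (A → B) → QueryTree n A → QueryTree n B
  f <$> t = t >>= leaf ∘ f

  traverse : ∀ {A m} → (Fin m → QueryTree n A) → QueryTree n (Vector A m)
  traverse {m = zero}  g = leaf λ ()
  traverse {m = suc m} g = g zero >>= λ a → (a Vector.∷_) <$> traverse (g ∘ suc)

  replicate : ∀ {A} m → QueryTree n A → QueryTree n (Vector A m)
  replicate m t = traverse {m = m} (const t)

  sampleCount : ℕ → Fin n → QueryTree n ℕ
  sampleCount zero    y = leaf 0
  sampleCount (suc m) y = node y (suc <$> sampleCount m y) (sampleCount m y)

  toAlg : QueryTree n (Fin n → ℕ) → Alg n
  toAlg (leaf m)     = done m
  toAlg (node y l r) = query y (toAlg l) (toAlg r)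

  depth : ∀ {A} → QueryTree n A → ℕ
  depth (leaf _)     = 0
  depth (node _ l r) = suc (depth l ℕ.⊔ depth r)

  queries-toAlg : ∀ t → queries (toAlg t) ≡ depth t
  queries-toAlg (leaf _)     = refl
  queries-toAlg (node _ l r) = cong₂ (λ u v → suc (u ℕ.⊔ v)) (queries-toAlg l) (queries-toAlg r)

  depth-<$> : ∀ {A B} (f : A → B) t → depth (f <$> t) ≡ depth t
  depth-<$> f (leaf _)     = refl
  depth-<$> f (node _ l r) = cong₂ (λ u v → suc (u ℕ.⊔ v)) (depth-<$> f l) (depth-<$> f r)

  depth->>= : ∀ {A B d} t {h : A → QueryTree n B} → (∀ a → depth (h a) ℕ.≤ d) →
              depth (t >>= h) ℕ.≤ depth t ℕ.+ d
  depth->>=         (leaf a)     h≤d = h≤d a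
  depth->>= {d = d} (node _ l r) h≤d = ℕ.s≤s (ℕ.⊔-lub
    (ℕ.≤-trans (depth->>= l h≤d) (ℕ.+-monoˡ-≤ d (ℕ.m≤m⊔n (depth l) (depth r))))
    (ℕ.≤-trans (depth->>= r h≤d) (ℕ.+-monoˡ-≤ d (ℕ.m≤n⊔m (depth l) (depth r)))))

  depth-traverse : ∀ {A m d} (g : Fin m → QueryTree n A) → (∀ i → depth (g i) ℕ.≤ d) →
                   depth (traverse g) ℕ.≤ m ℕ.* d
  depth-traverse {m = zero}  g g≤d = ℕ.z≤n
  depth-traverse {m = suc m} g g≤d = ℕ.≤-trans (depth->>= (g zero) rest≤) (ℕ.+-monoˡ-≤ _ (g≤d zero))
    where
    rest≤ : ∀ a → depth ((a Vector.∷_) <$> traverse (g ∘ suc)) ℕ.≤ m ℕ.* _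
    rest≤ a = ℕ.≤-trans (ℕ.≤-reflexive (depth-<$> (a Vector.∷_) (traverse (g ∘ suc))))
                        (depth-traverse (g ∘ suc) (g≤d ∘ suc))

  depth-sampleCount : ∀ m y → depth (sampleCount m y) ≡ m
  depth-sampleCount zero    y = refl
  depth-sampleCount (suc m) y = cong suc (begin
    depth (suc <$> T) ℕ.⊔ depth T   ≡⟨ cong (ℕ._⊔ depth T) (depth-<$> suc T) ⟩
    depth T ℕ.⊔ depth T             ≡⟨ ℕ.⊔-idem (depth T) ⟩
    depth T                         ≡⟨ depth-sampleCount m y ⟩
    m                               ∎)
    where
    open ≡-Reasoning
    T = sampleCount m y

  roundedCount : ℕ → Fin n → QueryTree n ℕ
  roundedCount k y = (λ X → (X ℕ.+ h) ℕ./ (2 ℕ.* h)) <$> sampleCount (16 ℕ.* suc k ℕ.* suc k) y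
    where h = 8 ℕ.* suc k

  votedCount : ℕ → ℕ → Fin n → QueryTree n ℕ
  votedCount k L y = majority (suc k) <$> replicate L (roundedCount k y)

  search : ℕ → ℕ → QueryTree n (Fin n → ℕ)
  search k L = differences <$> traverse (votedCount k L)

  depth-search : ∀ k L → depth (search k L) ℕ.≤ n ℕ.* (L ℕ.* (16 ℕ.* suc k ℕ.* suc k))
  depth-search k L = begin
    depth (search k L)                  ≡⟨ depth-<$> differences (traverse (votedCount k L)) ⟩
    depth (traverse (votedCount k L))   ≤⟨ depth-traverse (votedCount k L) voted ⟩
    n ℕ.* (L ℕ.* m₀)                    ∎
    where
    open ℕ.≤-Reasoning
    m₀ = 16 ℕ.* suc k ℕ.* suc k
    rounded : ∀ y → depth (roundedCount k y) ℕ.≤ m₀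
    rounded y = ℕ.≤-reflexive (trans (depth-<$> _ (sampleCount m₀ y)) (depth-sampleCount m₀ y))
    voted : ∀ y → depth (votedCount k L y) ℕ.≤ L ℕ.* m₀
    voted y = ℕ.≤-trans (ℕ.≤-reflexive (depth-<$> (majority (suc k)) (replicate L (roundedCount k y))))
                        (depth-traverse {m = L} (const (roundedCount k y)) (const (rounded y)))

open import Data.Integer.Base as ℤ using (+_)
import Data.Integer.Properties as ℤ
open import Data.Rational.Base
  using (ℚ; 0ℚ; 1ℚ; ½; _+_; _*_; _-_; -_; _/_; _≤_; Positive; nonNegative; nonPositive; toℚᵘ)
open import Data.Rational.Properties
import Data.Rational.Unnormalised.Base as ℚᵘ
import Data.Rational.Unnormalised.Properties as ℚᵘ
open import Data.Maybe.Base using (Maybe; decToMaybe)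
open import Tactic.RingSolver using (solve-∀)
open import Tactic.RingSolver.Core.AlmostCommutativeRing using (AlmostCommutativeRing; fromCommutativeRing)
open import Data.Nat.Tactic.RingSolver using () renaming (solve-∀ to ℕ-solve-∀)

ℚ-ring : AlmostCommutativeRing _ _
ℚ-ring = fromCommutativeRing +-*-commutativeRing (λ x → decToMaybe (0ℚ ≟ x))

0≤1 : 0ℚ ≤ 1ℚ
0≤1 = ≤ᵇ⇒≤ _

fromℕ : ℕ → ℚ
fromℕ n = + n / 1

toℚᵘ-/ : ∀ m d → toℚᵘ (+ m / suc d) ℚᵘ.≃ ℚᵘ.mkℚᵘ (+ m) d
toℚᵘ-/ m d = toℚᵘ-fromℚᵘ (ℚᵘ.mkℚᵘ (+ m) d)

fromℕ-homo-+ : ∀ m n → fromℕ (m ℕ.+ n) ≡ fromℕ m + fromℕ n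
fromℕ-homo-+ m n = toℚᵘ-injective (begin
  toℚᵘ (fromℕ (m ℕ.+ n))                   ≈⟨ toℚᵘ-/ (m ℕ.+ n) 0 ⟩
  ℚᵘ.mkℚᵘ (+ (m ℕ.+ n)) 0                  ≈⟨ ℚᵘ.*≡* eq ⟩
  ℚᵘ.mkℚᵘ (+ m) 0 ℚᵘ.+ ℚᵘ.mkℚᵘ (+ n) 0     ≈⟨ ℚᵘ.+-cong (toℚᵘ-/ m 0) (toℚᵘ-/ n 0) ⟨
  toℚᵘ (fromℕ m) ℚᵘ.+ toℚᵘ (fromℕ n)       ≈⟨ toℚᵘ-homo-+ (fromℕ m) (fromℕ n) ⟨
  toℚᵘ (fromℕ m + fromℕ n)                 ∎)
  where
  open ℚᵘ.≃-Reasoning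
  eq : + (m ℕ.+ n) ℤ.* + 1 ≡ (+ m ℤ.* + 1 ℤ.+ + n ℤ.* + 1) ℤ.* + 1
  eq = trans (ℤ.*-identityʳ _) (sym (trans (ℤ.*-identityʳ _)
         (cong₂ ℤ._+_ (ℤ.*-identityʳ (+ m)) (ℤ.*-identityʳ (+ n)))))

fromℕ-homo-* : ∀ m n → fromℕ (m ℕ.* n) ≡ fromℕ m * fromℕ n
fromℕ-homo-* m n = toℚᵘ-injective (begin
  toℚᵘ (fromℕ (m ℕ.* n))                   ≈⟨ toℚᵘ-/ (m ℕ.* n) 0 ⟩
  ℚᵘ.mkℚᵘ (+ (m ℕ.* n)) 0                  ≈⟨ ℚᵘ.*≡* (cong (ℤ._* + 1) (ℤ.pos-* m n)) ⟩
  ℚᵘ.mkℚᵘ (+ m) 0 ℚᵘ.* ℚᵘ.mkℚᵘ (+ n) 0     ≈⟨ ℚᵘ.*-cong (toℚᵘ-/ m 0) (toℚᵘ-/ n 0) ⟨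
  toℚᵘ (fromℕ m) ℚᵘ.* toℚᵘ (fromℕ n)       ≈⟨ toℚᵘ-homo-* (fromℕ m) (fromℕ n) ⟨
  toℚᵘ (fromℕ m * fromℕ n)                 ∎)
  where open ℚᵘ.≃-Reasoning

frac-*-denominator : ∀ c d → frac c (suc d) * fromℕ (suc d) ≡ fromℕ c
frac-*-denominator c d = toℚᵘ-injective (begin
  toℚᵘ (frac c (suc d) * fromℕ (suc d))                 ≈⟨ toℚᵘ-homo-* (frac c (suc d)) (fromℕ (suc d)) ⟩
  toℚᵘ (frac c (suc d)) ℚᵘ.* toℚᵘ (fromℕ (suc d))       ≈⟨ ℚᵘ.*-cong (toℚᵘ-/ c d) (toℚᵘ-/ (suc d) 0) ⟩
  ℚᵘ.mkℚᵘ (+ c) d ℚᵘ.* ℚᵘ.mkℚᵘ (+ suc d) 0              ≈⟨ ℚᵘ.*≡* eq ⟩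
  ℚᵘ.mkℚᵘ (+ c) 0                                       ≈⟨ toℚᵘ-/ c 0 ⟨
  toℚᵘ (fromℕ c)                                        ∎)
  where
  open ℚᵘ.≃-Reasoning
  eq : + c ℤ.* + suc d ℤ.* + 1 ≡ + c ℤ.* + (suc d ℕ.* 1)
  eq = trans (ℤ.*-identityʳ _) (cong (λ z → + c ℤ.* + z) (sym (ℕ.*-identityʳ (suc d))))

fromℕ-suc : ∀ n → fromℕ (suc n) ≡ 1ℚ + fromℕ n
fromℕ-suc = fromℕ-homo-+ 1

fromℕ-homo-^ : ∀ m e → fromℕ (m ℕ.^ e) ≡ powℚ (fromℕ m) e
fromℕ-homo-^ m zero    = refl
fromℕ-homo-^ m (suc e) = trans (fromℕ-homo-* m (m ℕ.^ e)) (cong (fromℕ m *_) (fromℕ-homo-^ m e))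

0≤fromℕ : ∀ n → 0ℚ ≤ fromℕ n
0≤fromℕ n = nonNegative⁻¹ (fromℕ n) {{normalize-nonNeg n 1}}

fromℕ-pos : ∀ n .{{_ : NonZero n}} → Positive (fromℕ n)
fromℕ-pos n = normalize-pos n 1

*-monoˡ-≤-0≤ : ∀ {r p q} → 0ℚ ≤ r → p ≤ q → r * p ≤ r * q
*-monoˡ-≤-0≤ {r} 0≤r = *-monoˡ-≤-nonNeg r {{nonNegative 0≤r}}

*-monoʳ-≤-0≤ : ∀ {r p q} → 0ℚ ≤ r → p ≤ q → p * r ≤ q * r
*-monoʳ-≤-0≤ {r} 0≤r = *-monoʳ-≤-nonNeg r {{nonNegative 0≤r}}

fromℕ-mono-≤ : ∀ {m n} → m ℕ.≤ n → fromℕ m ≤ fromℕ n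
fromℕ-mono-≤ {m} {n} m≤n = begin
  fromℕ m                      ≡⟨ +-identityʳ (fromℕ m) ⟨
  fromℕ m + 0ℚ                 ≤⟨ +-monoʳ-≤ (fromℕ m) (0≤fromℕ (n ℕ.∸ m)) ⟩
  fromℕ m + fromℕ (n ℕ.∸ m)    ≡⟨ fromℕ-homo-+ m (n ℕ.∸ m) ⟨
  fromℕ (m ℕ.+ (n ℕ.∸ m))      ≡⟨ cong fromℕ (ℕ.m+[n∸m]≡n m≤n) ⟩
  fromℕ n                      ∎
  where open ≤-Reasoning

fromℕ-∸ : ∀ {m n} → n ℕ.≤ m → fromℕ (m ℕ.∸ n) ≡ fromℕ m - fromℕ n
fromℕ-∸ {m} {n} n≤m = begin
  fromℕ (m ℕ.∸ n)                        ≡⟨ cancel (fromℕ n) (fromℕ (m ℕ.∸ n)) ⟨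
  (fromℕ n + fromℕ (m ℕ.∸ n)) - fromℕ n  ≡⟨ cong (_- fromℕ n) (fromℕ-homo-+ n (m ℕ.∸ n)) ⟨
  fromℕ (n ℕ.+ (m ℕ.∸ n)) - fromℕ n      ≡⟨ cong (λ z → fromℕ z - fromℕ n) (ℕ.m+[n∸m]≡n n≤m) ⟩
  fromℕ m - fromℕ n                      ∎
  where
  open ≡-Reasoning
  cancel : ∀ a b → (a + b) - a ≡ b
  cancel = solve-∀ ℚ-ring

fromℕ-4^ : ∀ {b} → b ℕ.≤ 1 → fromℕ (4 ℕ.^ b) ≡ 1ℚ + fromℕ 3 * fromℕ b
fromℕ-4^ ℕ.z≤n         = refl
fromℕ-4^ (ℕ.s≤s ℕ.z≤n) = refl

0≤1-x : ∀ {x} → x ≤ 1ℚ → 0ℚ ≤ 1ℚ - x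
0≤1-x {x} x≤1 = subst (_≤ 1ℚ - x) (+-inverseʳ x) (+-monoˡ-≤ (- x) x≤1)

1-x≤1 : ∀ {x} → 0ℚ ≤ x → 1ℚ - x ≤ 1ℚ
1-x≤1 0≤x = +-monoʳ-≤ 1ℚ (neg-antimono-≤ 0≤x)

sq : ℚ → ℚ
sq x = x * x

0≤sq : ∀ x → 0ℚ ≤ sq x
0≤sq x with ≤-total 0ℚ x
... | inj₁ 0≤x = nonNegative⁻¹ (sq x) {{nonNeg*nonNeg⇒nonNeg x {{nonNegative 0≤x}} x {{nonNegative 0≤x}}}}
... | inj₂ x≤0 = nonNegative⁻¹ (sq x) {{nonPos*nonPos⇒nonPos x {{nonPositive x≤0}} x {{nonPositive x≤0}}}}

sq-fromℕ-mono-≤ : ∀ {m n} → m ℕ.≤ n → sq (fromℕ m) ≤ sq (fromℕ n)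
sq-fromℕ-mono-≤ {m} {n} m≤n =
  subst₂ _≤_ (fromℕ-homo-* m m) (fromℕ-homo-* n n) (fromℕ-mono-≤ (ℕ.*-mono-≤ m≤n m≤n))

x*[1-x]≤¼ : ∀ x → x * (1ℚ - x) ≤ + 1 / 4
x*[1-x]≤¼ x = begin
  x * (1ℚ - x)                 ≡⟨ +-identityʳ (x * (1ℚ - x)) ⟨
  x * (1ℚ - x) + 0ℚ            ≤⟨ +-monoʳ-≤ (x * (1ℚ - x)) (0≤sq (x - ½)) ⟩
  x * (1ℚ - x) + sq (x - ½)    ≡⟨ complete-square x ½ ⟩
  ½ * ½ + x * (1ℚ - (½ + ½))   ≡⟨ cong (_+_ (½ * ½)) (*-zeroʳ x) ⟩
  + 1 / 4                      ∎
  where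
  open ≤-Reasoning
  complete-square : ∀ x h → x * (1ℚ - x) + (x - h) * (x - h) ≡ h * h + x * (1ℚ - (h + h))
  complete-square = solve-∀ ℚ-ring

-- Chebyshev's inequality, pointwise
round-miss-bound : ∀ X h c .{{_ : NonZero (2 ℕ.* h)}} →
  sq (fromℕ h) * fromℕ (miss c ((X ℕ.+ h) ℕ./ (2 ℕ.* h))) ≤ sq (fromℕ X - fromℕ (2 ℕ.* h ℕ.* c))
round-miss-bound X h c with (X ℕ.+ h) ℕ./ (2 ℕ.* h) ℕ.≟ c
... | yes _      = ≤-trans (≤-reflexive (*-zeroʳ (sq (fromℕ h)))) (0≤sq (fromℕ X - fromℕ (2 ℕ.* h ℕ.* c)))
... | no round≢c = ≤-trans (≤-reflexive (*-identityʳ (sq (fromℕ h)))) (far (round-≢⇒far X h c round≢c))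
  where
  open ≤-Reasoning
  μ = 2 ℕ.* h ℕ.* c
  flip : ∀ a b → (b - a) * (b - a) ≡ (a - b) * (a - b)
  flip = solve-∀ ℚ-ring
  far : h ℕ.+ μ ℕ.≤ X ⊎ h ℕ.+ X ℕ.≤ μ → sq (fromℕ h) ≤ sq (fromℕ X - fromℕ μ)
  far (inj₁ above) = begin
    sq (fromℕ h)                ≤⟨ sq-fromℕ-mono-≤ (ℕ.m+n≤o⇒m≤o∸n h above) ⟩
    sq (fromℕ (X ℕ.∸ μ))        ≡⟨ cong sq (fromℕ-∸ (ℕ.m+n≤o⇒n≤o h above)) ⟩
    sq (fromℕ X - fromℕ μ)      ∎
  far (inj₂ below) = begin
    sq (fromℕ h)                ≤⟨ sq-fromℕ-mono-≤ (ℕ.m+n≤o⇒m≤o∸n h below) ⟩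
    sq (fromℕ (μ ℕ.∸ X))        ≡⟨ cong sq (fromℕ-∸ (ℕ.m+n≤o⇒n≤o h below)) ⟩
    sq (fromℕ μ - fromℕ X)      ≡⟨ flip (fromℕ X) (fromℕ μ) ⟩
    sq (fromℕ X - fromℕ μ)      ∎

0≤powℚ : ∀ {x} m → 0ℚ ≤ x → 0ℚ ≤ powℚ x m
0≤powℚ     zero    0≤x = 0≤1
0≤powℚ {x} (suc m) 0≤x = subst (_≤ x * powℚ x m) (*-zeroʳ x) (*-monoˡ-≤-0≤ 0≤x (0≤powℚ m 0≤x))

powℚ-mono-≤ : ∀ {x y} m → 0ℚ ≤ x → x ≤ y → powℚ x m ≤ powℚ y m
powℚ-mono-≤ zero    0≤x x≤y = ≤-refl
powℚ-mono-≤ (suc m) 0≤x x≤y =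
  ≤-trans (*-monoʳ-≤-0≤ (0≤powℚ m 0≤x) x≤y) (*-monoˡ-≤-0≤ (≤-trans 0≤x x≤y) (powℚ-mono-≤ m 0≤x x≤y))

powℚ-suc≤ : ∀ {x} m → 0ℚ ≤ x → x ≤ 1ℚ → powℚ x (suc m) ≤ x
powℚ-suc≤ {x} m 0≤x x≤1 = begin
  x * powℚ x m    ≤⟨ *-monoˡ-≤-0≤ 0≤x (powℚ-mono-≤ m 0≤x x≤1) ⟩
  x * powℚ 1ℚ m   ≡⟨ cong (x *_) (powℚ-1 m) ⟩
  x * 1ℚ          ≡⟨ *-identityʳ x ⟩
  x               ∎
  where
  open ≤-Reasoning
  powℚ-1 : ∀ m → powℚ 1ℚ m ≡ 1ℚ
  powℚ-1 zero    = refl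
  powℚ-1 (suc m) = trans (*-identityˡ _) (powℚ-1 m)

powℚ-*-fromℕ^ : ∀ x d m → powℚ x m * fromℕ (d ℕ.^ m) ≡ powℚ (x * fromℕ d) m
powℚ-*-fromℕ^ x d zero    = refl
powℚ-*-fromℕ^ x d (suc m) = begin
  x * powℚ x m * fromℕ (d ℕ.* d ℕ.^ m)          ≡⟨ cong (x * powℚ x m *_) (fromℕ-homo-* d (d ℕ.^ m)) ⟩
  x * powℚ x m * (fromℕ d * fromℕ (d ℕ.^ m))    ≡⟨ interchange x (powℚ x m) (fromℕ d) _ ⟩
  x * fromℕ d * (powℚ x m * fromℕ (d ℕ.^ m))    ≡⟨ cong (x * fromℕ d *_) (powℚ-*-fromℕ^ x d m) ⟩
  x * fromℕ d * powℚ (x * fromℕ d) m            ∎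
  where
  open ≡-Reasoning
  interchange : ∀ a b c d → a * b * (c * d) ≡ a * c * (b * d)
  interchange = solve-∀ ℚ-ring

mix : ℚ → ℚ → ℚ → ℚ
mix p u v = p * u + (1ℚ - p) * v

mix-const : ∀ p c → p * c + (1ℚ - p) * c ≡ c
mix-const = solve-∀ ℚ-ring

mix-+ : ∀ p u v u′ v′ →
        p * (u + u′) + (1ℚ - p) * (v + v′) ≡ (p * u + (1ℚ - p) * v) + (p * u′ + (1ℚ - p) * v′)
mix-+ = solve-∀ ℚ-ring

mix-*ˡ : ∀ p r u v → p * (r * u) + (1ℚ - p) * (r * v) ≡ r * (p * u + (1ℚ - p) * v)
mix-*ˡ = solve-∀ ℚ-ring

mix-mono : ∀ {p u v u′ v′} → 0ℚ ≤ p → p ≤ 1ℚ → u ≤ u′ → v ≤ v′ → mix p u v ≤ mix p u′ v′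
mix-mono 0≤p p≤1 u≤u′ v≤v′ = +-mono-≤ (*-monoˡ-≤-0≤ 0≤p u≤u′) (*-monoˡ-≤-0≤ (0≤1-x p≤1) v≤v′)

module Expectation {n : ℕ} (p : Fin n → ℚ) (0≤p : ∀ y → 0ℚ ≤ p y) (p≤1 : ∀ y → p y ≤ 1ℚ) where

  𝔼 : ∀ {A} → QueryTree n A → (A → ℚ) → ℚ
  𝔼 (leaf a)     f = f a
  𝔼 (node y l r) f = mix (p y) (𝔼 l f) (𝔼 r f)

  module _ {A : Set} where

    𝔼->>= : ∀ {B} (t : QueryTree n A) (h : A → QueryTree n B) f → 𝔼 (t >>= h) f ≡ 𝔼 t (λ a → 𝔼 (h a) f)
    𝔼->>= (leaf a)     h f = refl
    𝔼->>= (node y l r) h f = cong₂ (mix (p y)) (𝔼->>= l h f) (𝔼->>= r h f)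

    𝔼-<$> : ∀ {B} (g : A → B) (t : QueryTree n A) f → 𝔼 (g <$> t) f ≡ 𝔼 t (f ∘ g)
    𝔼-<$> g t f = 𝔼->>= t (leaf ∘ g) f

    𝔼-cong : ∀ (t : QueryTree n A) {f g} → (∀ a → f a ≡ g a) → 𝔼 t f ≡ 𝔼 t g
    𝔼-cong (leaf a)     f≗g = f≗g a
    𝔼-cong (node y l r) f≗g = cong₂ (mix (p y)) (𝔼-cong l f≗g) (𝔼-cong r f≗g)

    𝔼-const : ∀ (t : QueryTree n A) c → 𝔼 t (const c) ≡ c
    𝔼-const (leaf a)     c = refl
    𝔼-const (node y l r) c = trans (cong₂ (mix (p y)) (𝔼-const l c) (𝔼-const r c)) (mix-const (p y) c)

    𝔼-+ : ∀ (t : QueryTree n A) f g → 𝔼 t (λ a → f a + g a) ≡ 𝔼 t f + 𝔼 t g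
    𝔼-+ (leaf a)     f g = refl
    𝔼-+ (node y l r) f g = trans (cong₂ (mix (p y)) (𝔼-+ l f g) (𝔼-+ r f g)) (mix-+ (p y) _ _ _ _)

    𝔼-*ˡ : ∀ (t : QueryTree n A) r f → 𝔼 t (λ a → r * f a) ≡ r * 𝔼 t f
    𝔼-*ˡ (leaf a)      r f = refl
    𝔼-*ˡ (node y l r′) r f = trans (cong₂ (mix (p y)) (𝔼-*ˡ l r f) (𝔼-*ˡ r′ r f)) (mix-*ˡ (p y) r _ _)

    𝔼-mono : ∀ (t : QueryTree n A) {f g} → (∀ a → f a ≤ g a) → 𝔼 t f ≤ 𝔼 t g
    𝔼-mono (leaf a)     f≤g = f≤g a
    𝔼-mono (node y l r) f≤g = mix-mono (0≤p y) (p≤1 y) (𝔼-mono l f≤g) (𝔼-mono r f≤g)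

    𝔼-const-+ : ∀ (t : QueryTree n A) c f → 𝔼 t (λ a → c + f a) ≡ c + 𝔼 t f
    𝔼-const-+ t c f = trans (𝔼-+ t (const c) f) (cong (_+ 𝔼 t f) (𝔼-const t c))

    𝔼-+-const : ∀ (t : QueryTree n A) f c → 𝔼 t (λ a → f a + c) ≡ 𝔼 t f + c
    𝔼-+-const t f c = trans (𝔼-+ t f (const c)) (cong (_+_ (𝔼 t f)) (𝔼-const t c))

    𝔼-nonNeg : ∀ (t : QueryTree n A) {f} → (∀ a → 0ℚ ≤ f a) → 0ℚ ≤ 𝔼 t f
    𝔼-nonNeg t 0≤f = subst (_≤ 𝔼 t _) (𝔼-const t 0ℚ) (𝔼-mono t 0≤f)

    𝔼-≤1 : ∀ (t : QueryTree n A) {f} → (∀ a → f a ≤ 1ℚ) → 𝔼 t f ≤ 1ℚ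
    𝔼-≤1 t f≤1 = subst (𝔼 t _ ≤_) (𝔼-const t 1ℚ) (𝔼-mono t f≤1)

    𝔼-complement : ∀ (t : QueryTree n A) f → 𝔼 t (λ a → 1ℚ - f a) ≡ 1ℚ - 𝔼 t f
    𝔼-complement t f = begin
      𝔼 t (λ a → 1ℚ - f a)          ≡⟨ 𝔼-cong t (λ a → negate (f a)) ⟩
      𝔼 t (λ a → 1ℚ + - 1ℚ * f a)   ≡⟨ 𝔼-const-+ t 1ℚ (λ a → - 1ℚ * f a) ⟩
      1ℚ + 𝔼 t (λ a → - 1ℚ * f a)   ≡⟨ cong (_+_ 1ℚ) (𝔼-*ˡ t (- 1ℚ) f) ⟩
      1ℚ + - 1ℚ * 𝔼 t f             ≡⟨ negate (𝔼 t f) ⟨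
      1ℚ - 𝔼 t f                    ∎
      where
      open ≡-Reasoning
      negate : ∀ x → 1ℚ - x ≡ 1ℚ + - 1ℚ * x
      negate = solve-∀ ℚ-ring

    𝔼-sq-shift : ∀ (t : QueryTree n A) f c →
                 𝔼 t (λ a → sq (f a + c)) ≡ 𝔼 t (sq ∘ f) + (c + c) * 𝔼 t f + sq c
    𝔼-sq-shift t f c = begin
      𝔼 t (λ a → sq (f a + c))                      ≡⟨ 𝔼-cong t (λ a → expand (f a) c) ⟩
      𝔼 t (λ a → sq (f a) + (c + c) * f a + sq c)   ≡⟨ 𝔼-+-const t (λ a → sq (f a) + (c + c) * f a) (sq c) ⟩
      𝔼 t (λ a → sq (f a) + (c + c) * f a) + sq c   ≡⟨ cong (_+ sq c) (𝔼-+ t (sq ∘ f) (λ a → (c + c) * f a)) ⟩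
      𝔼 t (sq ∘ f) + 𝔼 t (λ a → (c + c) * f a) + sq c
        ≡⟨ cong (λ z → 𝔼 t (sq ∘ f) + z + sq c) (𝔼-*ˡ t (c + c) f) ⟩
      𝔼 t (sq ∘ f) + (c + c) * 𝔼 t f + sq c         ∎
      where
      open ≡-Reasoning
      expand : ∀ x c → (x + c) * (x + c) ≡ x * x + (c + c) * x + c * c
      expand = solve-∀ ℚ-ring

  sampleCount-variance : ∀ m y →
    𝔼 (sampleCount m y) (λ X → sq (fromℕ X - fromℕ m * p y)) ≡ fromℕ m * (p y * (1ℚ - p y))
  sampleCount-variance zero    y = no-samples (p y)
    where
    no-samples : ∀ q → (0ℚ - 0ℚ * q) * (0ℚ - 0ℚ * q) ≡ 0ℚ * (q * (1ℚ - q))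
    no-samples = solve-∀ ℚ-ring
  sampleCount-variance (suc m) y = begin
    mix q (𝔼 (suc <$> T) F) (𝔼 T F)
      ≡⟨ cong (λ u → mix q u (𝔼 T F)) (𝔼-<$> suc T F) ⟩
    mix q (𝔼 T (F ∘ suc)) (𝔼 T F)
      ≡⟨ cong₂ (mix q) (𝔼-cong T shift-≤) (𝔼-cong T shift->) ⟩
    mix q (𝔼 T (λ X → sq (D X + (1ℚ - q)))) (𝔼 T (λ X → sq (D X + - q)))
      ≡⟨ cong₂ (mix q) (𝔼-sq-shift T D (1ℚ - q)) (𝔼-sq-shift T D (- q)) ⟩
    mix q (V + ((1ℚ - q) + (1ℚ - q)) * M + sq (1ℚ - q)) (V + (- q + - q) * M + sq (- q))
      ≡⟨ centred-step q V M ⟩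
    V + q * (1ℚ - q)
      ≡⟨ cong (_+ q * (1ℚ - q)) (sampleCount-variance m y) ⟩
    fromℕ m * (q * (1ℚ - q)) + q * (1ℚ - q)
      ≡⟨ one-more (fromℕ m) (q * (1ℚ - q)) ⟩
    (1ℚ + fromℕ m) * (q * (1ℚ - q))
      ≡⟨ cong (_* (q * (1ℚ - q))) (fromℕ-suc m) ⟨
    fromℕ (suc m) * (q * (1ℚ - q))
      ∎
    where
    open ≡-Reasoning
    T = sampleCount m y
    q = p y
    D F : ℕ → ℚ
    D X = fromℕ X - fromℕ m * q
    F X = sq (fromℕ X - fromℕ (suc m) * q)
    V = 𝔼 T (sq ∘ D)
    M = 𝔼 T D
    -- the terms linear in M cancel, whatever the mean M is
    centred-step : ∀ q V M → q * (V + ((1ℚ - q) + (1ℚ - q)) * M + (1ℚ - q) * (1ℚ - q))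
                               + (1ℚ - q) * (V + (- q + - q) * M + (- q) * (- q)) ≡ V + q * (1ℚ - q)
    centred-step = solve-∀ ℚ-ring
    one-more : ∀ a b → a * b + b ≡ (1ℚ + a) * b
    one-more = solve-∀ ℚ-ring
    shift-≤-ring : ∀ x u q → ((1ℚ + x) - (1ℚ + u) * q) * ((1ℚ + x) - (1ℚ + u) * q)
                             ≡ ((x - u * q) + (1ℚ - q)) * ((x - u * q) + (1ℚ - q))
    shift-≤-ring = solve-∀ ℚ-ring
    shift->-ring : ∀ x u q → (x - (1ℚ + u) * q) * (x - (1ℚ + u) * q)
                             ≡ ((x - u * q) + - q) * ((x - u * q) + - q)
    shift->-ring = solve-∀ ℚ-ring
    shift-≤ : ∀ X → F (suc X) ≡ sq (D X + (1ℚ - q))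
    shift-≤ X = trans (cong₂ (λ a b → sq (a - b * q)) (fromℕ-suc X) (fromℕ-suc m))
                      (shift-≤-ring (fromℕ X) (fromℕ m) q)
    shift-> : ∀ X → F X ≡ sq (D X + - q)
    shift-> X = trans (cong (λ b → sq (fromℕ X - b * q)) (fromℕ-suc m)) (shift->-ring (fromℕ X) (fromℕ m) q)

  module _ {A : Set} {m : ℕ} (g : Fin (suc m) → QueryTree n A) where

    private
      T = traverse (g ∘ suc)

    𝔼-traverse : ∀ H → 𝔼 (traverse g) H ≡ 𝔼 (g zero) (λ a → 𝔼 T (λ x → H (a Vector.∷ x)))
    𝔼-traverse H = trans (𝔼->>= (g zero) _ H) (𝔼-cong (g zero) (λ a → 𝔼-<$> (a Vector.∷_) T H))

    𝔼-traverse-+ : ∀ f F → 𝔼 (traverse g) (λ x → f (head x) + F (tail x)) ≡ 𝔼 (g zero) f + 𝔼 T F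
    𝔼-traverse-+ f F = begin
      𝔼 (traverse g) (λ x → f (head x) + F (tail x))   ≡⟨ 𝔼-traverse _ ⟩
      𝔼 (g zero) (λ a → 𝔼 T (λ x → f a + F x))         ≡⟨ 𝔼-cong (g zero) (λ a → 𝔼-const-+ T (f a) F) ⟩
      𝔼 (g zero) (λ a → f a + 𝔼 T F)                   ≡⟨ 𝔼-+-const (g zero) f (𝔼 T F) ⟩
      𝔼 (g zero) f + 𝔼 T F                             ∎
      where open ≡-Reasoning

    𝔼-traverse-* : ∀ f F → 𝔼 (traverse g) (λ x → f (head x) * F (tail x)) ≡ 𝔼 (g zero) f * 𝔼 T F
    𝔼-traverse-* f F = begin
      𝔼 (traverse g) (λ x → f (head x) * F (tail x))   ≡⟨ 𝔼-traverse _ ⟩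
      𝔼 (g zero) (λ a → 𝔼 T (λ x → f a * F x))         ≡⟨ 𝔼-cong (g zero) (λ a → 𝔼-*ˡ T (f a) F) ⟩
      𝔼 (g zero) (λ a → f a * 𝔼 T F)                   ≡⟨ 𝔼-cong (g zero) (λ a → *-comm (f a) (𝔼 T F)) ⟩
      𝔼 (g zero) (λ a → 𝔼 T F * f a)                   ≡⟨ 𝔼-*ˡ (g zero) (𝔼 T F) f ⟩
      𝔼 T F * 𝔼 (g zero) f                             ≡⟨ *-comm (𝔼 T F) (𝔼 (g zero) f) ⟩
      𝔼 (g zero) f * 𝔼 T F                             ∎
      where open ≡-Reasoning

  union-bound : ∀ {m} r ε (g : Fin m → QueryTree n ℕ) (c : Vector ℕ m) →
                (∀ i → r * 𝔼 (g i) (fromℕ ∘ miss (c i)) ≤ ε) →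
                r * 𝔼 (traverse g) (fromℕ ∘ mismatches c) ≤ fromℕ m * ε
  union-bound {zero}  r ε g c _     = ≤-reflexive (trans (*-zeroʳ r) (sym (*-zeroˡ ε)))
  union-bound {suc m} r ε g c bound = begin
    r * 𝔼 (traverse g) (fromℕ ∘ mismatches c)
      ≡⟨ cong (r *_) (𝔼-cong (traverse g) (λ x → fromℕ-homo-+ (miss (head c) (head x)) _)) ⟩
    r * 𝔼 (traverse g) (λ x → fromℕ (miss (head c) (head x)) + fromℕ (mismatches (tail c) (tail x)))
      ≡⟨ cong (r *_) (𝔼-traverse-+ g (fromℕ ∘ miss (head c)) (fromℕ ∘ mismatches (tail c))) ⟩
    r * (𝔼 (g zero) (fromℕ ∘ miss (head c)) + 𝔼 (traverse (g ∘ suc)) (fromℕ ∘ mismatches (tail c)))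
      ≡⟨ *-distribˡ-+ r _ _ ⟩
    r * 𝔼 (g zero) (fromℕ ∘ miss (head c)) + r * 𝔼 (traverse (g ∘ suc)) (fromℕ ∘ mismatches (tail c))
      ≤⟨ +-mono-≤ (bound zero) (union-bound r ε (g ∘ suc) (tail c) (bound ∘ suc)) ⟩
    ε + fromℕ m * ε
      ≡⟨ one-more (fromℕ m) ε ⟩
    (1ℚ + fromℕ m) * ε
      ≡⟨ cong (_* ε) (fromℕ-suc m) ⟨
    fromℕ (suc m) * ε
      ∎
    where
    open ≤-Reasoning
    one-more : ∀ a b → b + a * b ≡ (1ℚ + a) * b
    one-more = solve-∀ ℚ-ring

  𝔼-replicate-4^mismatches : ∀ m c (t : QueryTree n ℕ) →
    𝔼 (replicate m t) (λ x → fromℕ (4 ℕ.^ mismatches (const c) x))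
      ≡ powℚ (𝔼 t (λ a → fromℕ (4 ℕ.^ miss c a))) m
  𝔼-replicate-4^mismatches zero    c t = refl
  𝔼-replicate-4^mismatches (suc m) c t = begin
    𝔼 (replicate (suc m) t) (λ x → fromℕ (4 ℕ.^ mismatches (const c) x))
      ≡⟨ 𝔼-cong (replicate (suc m) t) (λ x → split (miss c (head x)) (mismatches (const c) (tail x))) ⟩
    𝔼 (replicate (suc m) t) (λ x → w (head x) * W (tail x))
      ≡⟨ 𝔼-traverse-* (const t) w W ⟩
    𝔼 t w * 𝔼 (replicate m t) W
      ≡⟨ cong (𝔼 t w *_) (𝔼-replicate-4^mismatches m c t) ⟩
    𝔼 t w * powℚ (𝔼 t w) m
      ∎
    where
    open ≡-Reasoning
    w : ℕ → ℚ
    w a = fromℕ (4 ℕ.^ miss c a)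
    W : Vector ℕ m → ℚ
    W x = fromℕ (4 ℕ.^ mismatches (const c) x)
    split : ∀ a b → fromℕ (4 ℕ.^ (a ℕ.+ b)) ≡ fromℕ (4 ℕ.^ a) * fromℕ (4 ℕ.^ b)
    split a b = trans (cong fromℕ (ℕ.^-distribˡ-+-* 4 a b)) (fromℕ-homo-* (4 ℕ.^ a) (4 ℕ.^ b))

  -- Markov's inequality for the weight 4 ^ mismatches, whose expectation factorises over the trials
  majority-failure : ∀ m K c (t : QueryTree n ℕ) {δ} → c ℕ.≤ K → 𝔼 t (fromℕ ∘ miss c) ≤ δ →
    fromℕ (2 ℕ.^ m) * 𝔼 (majority K <$> replicate m t) (fromℕ ∘ miss c) ≤ powℚ (1ℚ + fromℕ 3 * δ) m
  majority-failure m K c t {δ} c≤K P≤δ = begin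
    fromℕ (2 ℕ.^ m) * 𝔼 (majority K <$> R) (fromℕ ∘ miss c)
      ≡⟨ cong (fromℕ (2 ℕ.^ m) *_) (𝔼-<$> (majority K) R (fromℕ ∘ miss c)) ⟩
    fromℕ (2 ℕ.^ m) * 𝔼 R (λ x → fromℕ (miss c (majority K x)))
      ≡⟨ 𝔼-*ˡ R (fromℕ (2 ℕ.^ m)) _ ⟨
    𝔼 R (λ x → fromℕ (2 ℕ.^ m) * fromℕ (miss c (majority K x)))
      ≤⟨ 𝔼-mono R markov ⟩
    𝔼 R (λ x → fromℕ (4 ℕ.^ mismatches (const c) x))
      ≡⟨ 𝔼-replicate-4^mismatches m c t ⟩
    powℚ (𝔼 t (λ a → fromℕ (4 ℕ.^ miss c a))) m
      ≡⟨ cong (λ z → powℚ z m) weight ⟩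
    powℚ (1ℚ + fromℕ 3 * P) m
      ≤⟨ powℚ-mono-≤ m 0≤1+3P (+-monoʳ-≤ 1ℚ (*-monoˡ-≤-0≤ (0≤fromℕ 3) P≤δ)) ⟩
    powℚ (1ℚ + fromℕ 3 * δ) m
      ∎
    where
    open ≤-Reasoning
    R = replicate m t
    P = 𝔼 t (fromℕ ∘ miss c)
    markov : ∀ x → fromℕ (2 ℕ.^ m) * fromℕ (miss c (majority K x)) ≤ fromℕ (4 ℕ.^ mismatches (const c) x)
    markov x = subst (_≤ _) (fromℕ-homo-* (2 ℕ.^ m) _) (fromℕ-mono-≤ (majority-miss-bound K x c≤K))
    weight : 𝔼 t (λ a → fromℕ (4 ℕ.^ miss c a)) ≡ 1ℚ + fromℕ 3 * P
    weight = begin-equality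
      𝔼 t (λ a → fromℕ (4 ℕ.^ miss c a))            ≡⟨ 𝔼-cong t (λ a → fromℕ-4^ (miss≤1 c a)) ⟩
      𝔼 t (λ a → 1ℚ + fromℕ 3 * fromℕ (miss c a))   ≡⟨ 𝔼-const-+ t 1ℚ _ ⟩
      1ℚ + 𝔼 t (λ a → fromℕ 3 * fromℕ (miss c a))   ≡⟨ cong (_+_ 1ℚ) (𝔼-*ˡ t (fromℕ 3) _) ⟩
      1ℚ + fromℕ 3 * P                               ∎
    0≤1+3P : 0ℚ ≤ 1ℚ + fromℕ 3 * P
    0≤1+3P = ≤-trans 0≤1 (+-monoʳ-≤ 1ℚ (*-monoˡ-≤-0≤ (0≤fromℕ 3) (𝔼-nonNeg t (0≤fromℕ ∘ miss c))))

  roundedCount-miss : ∀ k y c → p y * fromℕ (suc k) ≡ fromℕ c →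
                      𝔼 (roundedCount k y) (fromℕ ∘ miss c) ≤ + 1 / 16
  roundedCount-miss k y c p*K≡c = *-cancelˡ-≤-pos (sq (fromℕ h)) {{h²-pos}} (begin
    sq (fromℕ h) * 𝔼 (round <$> T) (fromℕ ∘ miss c)
      ≡⟨ cong (sq (fromℕ h) *_) (𝔼-<$> round T (fromℕ ∘ miss c)) ⟩
    sq (fromℕ h) * 𝔼 T (λ X → fromℕ (miss c (round X)))
      ≡⟨ 𝔼-*ˡ T (sq (fromℕ h)) _ ⟨
    𝔼 T (λ X → sq (fromℕ h) * fromℕ (miss c (round X)))
      ≤⟨ 𝔼-mono T (λ X → round-miss-bound X h c) ⟩
    𝔼 T (λ X → sq (fromℕ X - fromℕ (2 ℕ.* h ℕ.* c)))
      ≡⟨ 𝔼-cong T (λ X → cong (λ μ → sq (fromℕ X - μ)) mean) ⟩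
    𝔼 T (λ X → sq (fromℕ X - fromℕ m₀ * p y))
      ≡⟨ sampleCount-variance m₀ y ⟩
    fromℕ m₀ * (p y * (1ℚ - p y))
      ≤⟨ *-monoˡ-≤-0≤ (0≤fromℕ m₀) (x*[1-x]≤¼ (p y)) ⟩
    fromℕ m₀ * (+ 1 / 4)
      ≡⟨ constants ⟩
    sq (fromℕ h) * (+ 1 / 16)
      ∎)
    where
    open ≤-Reasoning
    K = suc k
    h = 8 ℕ.* K
    m₀ = 16 ℕ.* K ℕ.* K
    T = sampleCount m₀ y
    round : ℕ → ℕ
    round X = (X ℕ.+ h) ℕ./ (2 ℕ.* h)
    h²-pos : Positive (sq (fromℕ h))
    h²-pos = subst Positive (fromℕ-homo-* h h) (fromℕ-pos (h ℕ.* h))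
    mean : fromℕ (2 ℕ.* h ℕ.* c) ≡ fromℕ m₀ * p y
    mean = begin-equality
      fromℕ (2 ℕ.* h ℕ.* c)               ≡⟨ cong fromℕ (regroup K c) ⟩
      fromℕ (16 ℕ.* K ℕ.* c)              ≡⟨ fromℕ-homo-* (16 ℕ.* K) c ⟩
      fromℕ (16 ℕ.* K) * fromℕ c          ≡⟨ cong (fromℕ (16 ℕ.* K) *_) p*K≡c ⟨
      fromℕ (16 ℕ.* K) * (p y * fromℕ K)  ≡⟨ rotate (fromℕ (16 ℕ.* K)) (p y) (fromℕ K) ⟩
      fromℕ (16 ℕ.* K) * fromℕ K * p y    ≡⟨ cong (_* p y) (fromℕ-homo-* (16 ℕ.* K) K) ⟨
      fromℕ m₀ * p y                      ∎
      where
      regroup : ∀ K c → 2 ℕ.* (8 ℕ.* K) ℕ.* c ≡ 16 ℕ.* K ℕ.* c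
      regroup = ℕ-solve-∀
      rotate : ∀ a b c → a * (b * c) ≡ a * c * b
      rotate = solve-∀ ℚ-ring
    constants : fromℕ m₀ * (+ 1 / 4) ≡ sq (fromℕ h) * (+ 1 / 16)
    constants = begin-equality
      fromℕ m₀ * (+ 1 / 4)
        ≡⟨ cong (_* (+ 1 / 4)) (trans (fromℕ-homo-* (16 ℕ.* K) K) (cong (_* fromℕ K) (fromℕ-homo-* 16 K))) ⟩
      fromℕ 16 * fromℕ K * fromℕ K * (+ 1 / 4)
        ≡⟨ factor (fromℕ 16) (fromℕ K) (+ 1 / 4) ⟩
      sq (fromℕ K) * (fromℕ 16 * (+ 1 / 4))
        ≡⟨⟩
      sq (fromℕ K) * (fromℕ 8 * fromℕ 8 * (+ 1 / 16))
        ≡⟨ factor′ (fromℕ 8) (fromℕ K) (+ 1 / 16) ⟨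
      sq (fromℕ 8 * fromℕ K) * (+ 1 / 16)
        ≡⟨ cong (λ z → sq z * (+ 1 / 16)) (fromℕ-homo-* 8 K) ⟨
      sq (fromℕ h) * (+ 1 / 16)
        ∎
      where
      factor : ∀ a b c → a * b * b * c ≡ (b * b) * (a * c)
      factor = solve-∀ ℚ-ring
      factor′ : ∀ a b c → (a * b) * (a * b) * c ≡ (b * b) * (a * a * c)
      factor′ = solve-∀ ℚ-ring

𝟙 : Bool → ℚ
𝟙 b = if b then 1ℚ else 0ℚ

0≤𝟙 : ∀ b → 0ℚ ≤ 𝟙 b
0≤𝟙 true  = 0≤1
0≤𝟙 false = ≤-refl

𝟙≤1 : ∀ b → 𝟙 b ≤ 1ℚ
𝟙≤1 true  = ≤-refl
𝟙≤1 false = 0≤1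

module _ {n k : ℕ} (S : Vec (Fin n) (suc k)) where

  counts : Fin n → ℕ
  counts y = countLe y S

  probLe : Fin n → ℚ
  probLe y = frac (counts y) (suc k)

  0≤probLe : ∀ y → 0ℚ ≤ probLe y
  0≤probLe y = nonNegative⁻¹ (probLe y) {{normalize-nonNeg (counts y) (suc k)}}

  probLe≤1 : ∀ y → probLe y ≤ 1ℚ
  probLe≤1 y = *-cancelʳ-≤-pos (fromℕ (suc k)) {{fromℕ-pos (suc k)}} (begin
    probLe y * fromℕ (suc k)   ≡⟨ frac-*-denominator (counts y) k ⟩
    fromℕ (counts y)           ≤⟨ fromℕ-mono-≤ (countLe≤length y S) ⟩
    fromℕ (suc k)              ≡⟨ *-identityˡ (fromℕ (suc k)) ⟨
    1ℚ * fromℕ (suc k)         ∎)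
    where open ≤-Reasoning

  open Expectation probLe 0≤probLe probLe≤1

  successProb-toAlg : ∀ t → successProb S (toAlg t) ≡ 𝔼 t (𝟙 ∘ correct S)
  successProb-toAlg (leaf m)     = refl
  successProb-toAlg (node y l r) = cong₂ (mix (probLe y)) (successProb-toAlg l) (successProb-toAlg r)

  0≤successProb : ∀ t → 0ℚ ≤ successProb S (toAlg t)
  0≤successProb t = subst (0ℚ ≤_) (sym (successProb-toAlg t)) (𝔼-nonNeg t (0≤𝟙 ∘ correct S))

  successProb≤1 : ∀ t → successProb S (toAlg t) ≤ 1ℚ
  successProb≤1 t = subst (_≤ 1ℚ) (sym (successProb-toAlg t)) (𝔼-≤1 t (𝟙≤1 ∘ correct S))

  failure≤mismatches : ∀ x → 1ℚ - 𝟙 (correct S (differences x)) ≤ fromℕ (mismatches counts x)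
  failure≤mismatches x with mismatches counts x in none
  ... | zero  = ≤-reflexive (cong (λ b → 1ℚ - 𝟙 b) (correct-differences S (mismatches≡0⇒≗ counts x none)))
  ... | suc d = ≤-trans (1-x≤1 (0≤𝟙 (correct S (differences x)))) (fromℕ-mono-≤ {1} {suc d} (ℕ.s≤s ℕ.z≤n))

  search-failure : ∀ L → fromℕ (2 ℕ.^ L) * (1ℚ - successProb S (toAlg (search k L)))
                         ≤ fromℕ n * powℚ (1ℚ + fromℕ 3 * (+ 1 / 16)) L
  search-failure L = begin
    fromℕ (2 ℕ.^ L) * (1ℚ - successProb S (toAlg (search k L)))
      ≡⟨ cong (λ s → fromℕ (2 ℕ.^ L) * (1ℚ - s))
              (trans (successProb-toAlg (search k L)) (𝔼-<$> differences V _)) ⟩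
    fromℕ (2 ℕ.^ L) * (1ℚ - 𝔼 V (λ x → 𝟙 (correct S (differences x))))
      ≡⟨ cong (fromℕ (2 ℕ.^ L) *_) (𝔼-complement V _) ⟨
    fromℕ (2 ℕ.^ L) * 𝔼 V (λ x → 1ℚ - 𝟙 (correct S (differences x)))
      ≤⟨ *-monoˡ-≤-0≤ (0≤fromℕ (2 ℕ.^ L)) (𝔼-mono V failure≤mismatches) ⟩
    fromℕ (2 ℕ.^ L) * 𝔼 V (fromℕ ∘ mismatches counts)
      ≤⟨ union-bound (fromℕ (2 ℕ.^ L)) _ (votedCount k L) counts voted ⟩
    fromℕ n * powℚ (1ℚ + fromℕ 3 * (+ 1 / 16)) L
      ∎
    where
    open ≤-Reasoning
    V = traverse (votedCount k L)
    voted : ∀ y → fromℕ (2 ℕ.^ L) * 𝔼 (votedCount k L y) (fromℕ ∘ miss (counts y))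
                  ≤ powℚ (1ℚ + fromℕ 3 * (+ 1 / 16)) L
    voted y = majority-failure L (suc k) (counts y) (roundedCount k y) (countLe≤length y S)
                (roundedCount-miss k y (counts y) (frac-*-denominator (counts y) k))

failure^b*n^a≤1 : ∀ {P} n a b L → 0ℚ ≤ P → P ≤ 1ℚ → 1 ℕ.≤ b →
  fromℕ (2 ℕ.^ L) * P ≤ fromℕ n * powℚ (1ℚ + fromℕ 3 * (+ 1 / 16)) L →
  n ℕ.^ suc a ℕ.* 19 ℕ.^ L ℕ.≤ 32 ℕ.^ L →
  powℚ P b * powℚ (fromℕ n) a ≤ 1ℚ
failure^b*n^a≤1 {P} n a (suc b) L 0≤P P≤1 _ scaled numeric = ≤-trans
  (*-monoʳ-≤-0≤ (0≤powℚ a (0≤fromℕ n)) (powℚ-suc≤ b 0≤P P≤1))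
  (*-cancelˡ-≤-pos (fromℕ (32 ℕ.^ L)) {{fromℕ-pos (32 ℕ.^ L) {{ℕ.m^n≢0 32 L}}}} (begin
    fromℕ (32 ℕ.^ L) * (P * nᵃ)
      ≡⟨ cong (_* (P * nᵃ)) (trans (cong fromℕ (^-distrib-* 16 2 L)) (fromℕ-homo-* (16 ℕ.^ L) (2 ℕ.^ L))) ⟩
    fromℕ (16 ℕ.^ L) * fromℕ (2 ℕ.^ L) * (P * nᵃ)
      ≡⟨ regroup (fromℕ (16 ℕ.^ L)) (fromℕ (2 ℕ.^ L)) P nᵃ ⟩
    fromℕ (16 ℕ.^ L) * (fromℕ (2 ℕ.^ L) * P) * nᵃ
      ≤⟨ *-monoʳ-≤-0≤ (0≤powℚ a (0≤fromℕ n)) (*-monoˡ-≤-0≤ (0≤fromℕ (16 ℕ.^ L)) scaled) ⟩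
    fromℕ (16 ℕ.^ L) * (fromℕ n * powℚ r L) * nᵃ
      ≡⟨ regroup′ (fromℕ (16 ℕ.^ L)) (fromℕ n) (powℚ r L) nᵃ ⟩
    fromℕ n * nᵃ * (powℚ r L * fromℕ (16 ℕ.^ L))
      ≡⟨ cong₂ _*_ (sym (fromℕ-homo-^ n (suc a))) (trans (powℚ-*-fromℕ^ r 16 L) (sym (fromℕ-homo-^ 19 L))) ⟩
    fromℕ (n ℕ.^ suc a) * fromℕ (19 ℕ.^ L)
      ≡⟨ fromℕ-homo-* (n ℕ.^ suc a) (19 ℕ.^ L) ⟨
    fromℕ (n ℕ.^ suc a ℕ.* 19 ℕ.^ L)
      ≤⟨ fromℕ-mono-≤ numeric ⟩
    fromℕ (32 ℕ.^ L)
      ≡⟨ *-identityʳ (fromℕ (32 ℕ.^ L)) ⟨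
    fromℕ (32 ℕ.^ L) * 1ℚ
      ∎))
  where
  open ≤-Reasoning
  nᵃ = powℚ (fromℕ n) a
  r = 1ℚ + fromℕ 3 * (+ 1 / 16)
  regroup : ∀ a b c d → a * b * (c * d) ≡ a * (b * c) * d
  regroup = solve-∀ ℚ-ring
  regroup′ : ∀ a b c d → a * (b * c) * d ≡ b * d * (c * a)
  regroup′ = solve-∀ ℚ-ring

corollary1 : (a b : ℕ) → 1 ℕ.≤ a → 1 ℕ.≤ b →
    ∃ λ (C : ℕ) → ∀ (n k : ℕ) → 1 ℕ.≤ n → n ℕ.≤ k →
      ∃ λ (A : Alg n) →
        (queries A ℕ.≤ C ℕ.* (k ℕ.* k ℕ.* n ℕ.* ⌊log₂ n ⌋)) ×
        (∀ (S : Vec (Fin n) k) →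
          powℚ (1ℚ - successProb S A) b * powℚ (((+ n) / 1)) a ≤ 1ℚ)
corollary1 a b _ 1≤b = 48 ℕ.* suc a , solution
  where
  solution : ∀ n k → 1 ℕ.≤ n → n ℕ.≤ k → ∃ λ (A : Alg n) →
    (queries A ℕ.≤ 48 ℕ.* suc a ℕ.* (k ℕ.* k ℕ.* n ℕ.* ⌊log₂ n ⌋)) ×
    (∀ (S : Vec (Fin n) k) → powℚ (1ℚ - successProb S A) b * powℚ (fromℕ n) a ≤ 1ℚ)
  solution n zero    1≤n n≤0 = contradiction (ℕ.≤-trans 1≤n n≤0) λ ()
  solution n (suc k) _   _   = toAlg t , query-bound , λ S →
    failure^b*n^a≤1 n a b L (0≤1-x (successProb≤1 S t)) (1-x≤1 (0≤successProb S t)) 1≤b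
      (search-failure S L) (n^[1+a]*19^L≤32^L n a ℓ (n≤4^⌊log₂n⌋ n))
    where
    ℓ = ⌊log₂ n ⌋
    L = 3 ℕ.* (suc a ℕ.* ℓ)
    t = search {n} k L
    query-bound : queries (toAlg t) ℕ.≤ 48 ℕ.* suc a ℕ.* (suc k ℕ.* suc k ℕ.* n ℕ.* ℓ)
    query-bound = subst₂ ℕ._≤_ (sym (queries-toAlg t)) (count n (suc k) (suc a) ℓ) (depth-search k L)
      where
      count : ∀ n K a ℓ →
              n ℕ.* (3 ℕ.* (a ℕ.* ℓ) ℕ.* (16 ℕ.* K ℕ.* K)) ≡ 48 ℕ.* a ℕ.* (K ℕ.* K ℕ.* n ℕ.* ℓ)
      count = ℕ-solve-∀
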